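{- Let ${\cal A}\le{\cal B}$ be partial pairs. Then for every $\lambda$-term $M$ and all environments $\rho:Var\to{\cal P}(A)$ and $\sigma:Var\to{\cal P}(B)$ with $\rho(x)\subseteq\sigma(x)$ for every variable $x$, we have $M^{\cal A}_\rho\subseteq M^{\cal B}_\sigma$.
   Context: A partial pair is ${\cal A}=(A,c_{\cal A})$ with $A$ a set and $c_{\cal A}:A^*\times A\rightharpoonup A$ a partial injective function ($A^*$ = finite subsets of $A$). Interpretation in a partial pair: $x_\rho=\rho(x)$; $(MN)_\rho=\{\alpha\in A:\exists a\subseteq N_\rho\text{ finite},(a,\alpha)\in dom(c_{\cal A}),c_{\cal A}(a,\alpha)\in M_\rho\}$; $(\lambda x.M)_\rho=\{c_{\cal A}(a,\alpha):(a,\alpha)\in dom(c_{\cal A}),\alpha\in M_{\rho[x:=a]}\}$. ${\cal A}\le{\cal B}$ means $A\subseteq B$ and $c_{\cal B}(a,\alpha)=c_{\cal A}(a,\alpha)$ for all $(a,\alpha)\in dom(c_{\cal A})$. -}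

module Defs where

open import Data.Nat using (ℕ; _≟_)
open import Data.List using (List)
open import Data.List.Membership.Propositional using (_∈_)
open import Data.List.Relation.Unary.All using (All)
open import Data.Product using (Σ; _×_; ∃)
open import Relation.Binary.PropositionalEquality using (_≡_)
open import Relation.Nullary using (yes; no)

-- Finite subsets of the ambient universe U are represented by lists,
-- identified up to having the same elements.
SameElems : {U : Set} → List U → List U → Set
SameElems {U} a b = (u : U) → (u ∈ a → u ∈ b) × (u ∈ b → u ∈ a)

Pred : Set → Set₁
Pred U = U → Set

_⊆_ : {U : Set} → Pred U → Pred U → Set
_⊆_ {U} P Q = (u : U) → P u → Q u

-- A partial pair whose carrier A is a subset of an ambient universe U.
-- The partial function c : A* × A ⇀ A is given by its graph:
-- c a α γ  means  (a , α) ∈ dom(c)  and  c(a , α) = γ.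
record PartialPair (U : Set) : Set₁ where
  field
    El     : Pred U
    c      : List U → U → U → Set
    c-dom  : ∀ {a α γ} → c a α γ → All El a × El α
    c-cod  : ∀ {a α γ} → c a α γ → El γ
    -- c is a function on finite *sets*
    c-resp : ∀ {a b α γ} → SameElems a b → c a α γ → c b α γ
    c-func : ∀ {a α γ δ} → c a α γ → c a α δ → γ ≡ δ
    c-inj  : ∀ {a b α β γ} → c a α γ → c b β γ → SameElems a b × α ≡ β

open PartialPair public

_≤ₚ_ : {U : Set} → PartialPair U → PartialPair U → Set
_≤ₚ_ {U} 𝒜 ℬ =
  (El 𝒜 ⊆ El ℬ) ×
  (∀ (a : List U) (α γ : U) → c 𝒜 a α γ → c ℬ a α γ)

data Term : Set where
  var : ℕ → Term
  app : Term → Term → Term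
  lam : ℕ → Term → Term

Env : Set → Set₁
Env U = ℕ → Pred U

update : {U : Set} → Env U → ℕ → List U → Env U
update ρ x a y with x ≟ y
... | yes _ = λ u → u ∈ a
... | no  _ = ρ y

⟦_⟧ : {U : Set} → Term → (𝒜 : PartialPair U) → Env U → Pred U
⟦ var x ⟧ 𝒜 ρ = ρ x
⟦_⟧ {U} (app M N) 𝒜 ρ α =
  El 𝒜 α × Σ (List U) (λ a → All (⟦ N ⟧ 𝒜 ρ) a × Σ U (λ γ → c 𝒜 a α γ × ⟦ M ⟧ 𝒜 ρ γ))
⟦_⟧ {U} (lam x M) 𝒜 ρ γ =
  Σ (List U) (λ a → Σ U (λ α → c 𝒜 a α γ × ⟦ M ⟧ 𝒜 (update ρ x a) α))

{-# OPTIONS --safe #-}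
-- Every clause of the interpretation is a positive, existential condition on the
-- environment and on the graph of c, and c_ℬ extends c_𝒜; so the interpretation is
-- monotone in both, by structural induction on the term.
module Submission where

open import Defs
open import Data.Nat using (_≟_)
open import Data.Product using (_,_)
open import Data.List.Relation.Unary.All as All using ()
open import Relation.Nullary using (yes; no)

_⊆ₑ_ : {U : Set} → Env U → Env U → Set
ρ ⊆ₑ σ = ∀ x → ρ x ⊆ σ x

update-mono : {U : Set} {ρ σ : Env U} → ρ ⊆ₑ σ → ∀ x a → update ρ x a ⊆ₑ update σ x a
update-mono ρ⊆σ x a y with x ≟ y
... | yes _ = λ _ u∈a → u∈a
... | no  _ = ρ⊆σ y

⟦⟧-mono : {U : Set} {𝒜 ℬ : PartialPair U} → 𝒜 ≤ₚ ℬ →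
          ∀ M {ρ σ} → ρ ⊆ₑ σ → ⟦ M ⟧ 𝒜 ρ ⊆ ⟦ M ⟧ ℬ σ
⟦⟧-mono 𝒜≤ℬ (var x) ρ⊆σ = ρ⊆σ x
⟦⟧-mono 𝒜≤ℬ@(El⊆ , c⊆) (app M N) ρ⊆σ α (α∈A , a , a⊆N , γ , caαγ , γ∈M) =
  El⊆ α α∈A , a , All.map (λ {u} → ⟦⟧-mono 𝒜≤ℬ N ρ⊆σ u) a⊆N ,
  γ , c⊆ a α γ caαγ , ⟦⟧-mono 𝒜≤ℬ M ρ⊆σ γ γ∈M
⟦⟧-mono 𝒜≤ℬ@(_ , c⊆) (lam x M) ρ⊆σ γ (a , α , caαγ , α∈M) =
  a , α , c⊆ a α γ caαγ , ⟦⟧-mono 𝒜≤ℬ M (update-mono ρ⊆σ x a) α α∈M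

-- The hypotheses that ρ and σ take values in the carriers are not needed.
lemma3 : {U : Set} (𝒜 ℬ : PartialPair U) → 𝒜 ≤ₚ ℬ →
           (M : Term) (ρ σ : Env U) →
           (∀ x → ρ x ⊆ El 𝒜) → (∀ x → σ x ⊆ El ℬ) →
           (∀ x → ρ x ⊆ σ x) →
           ⟦ M ⟧ 𝒜 ρ ⊆ ⟦ M ⟧ ℬ σ
lemma3 𝒜 ℬ 𝒜≤ℬ M ρ σ _ _ ρ⊆σ = ⟦⟧-mono 𝒜≤ℬ M ρ⊆σ
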